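{- Let $N$ be a 0,1-network with reactions $y_1\to y_1',\dots,y_m\to y_m'$, let $\mathscr E$ be a multiset over the edges of $\mathcal H_N$, and let $v_j$ be a vertex of $\mathcal H_N$. If $v_j$ is almost balanced with respect to the 2-coloring $\mathscr E=\mathscr E_r\sqcup\mathscr E_b$, then for some positive integer $k$, $$k\kappa_j x^{y_j}=\sum_{E_s\in\mathscr E_r}\dot x_s-\sum_{E_s\in\mathscr E_b}\dot x_s,$$ where the sums run over the species hyperedges in $\mathscr E_r$ (resp. $\mathscr E_b$), each counted with its multiplicity, and $y_j$ is the reactant of the $j$-th reaction.
   Context: A chemical reaction network $N=(\mathscr S,\mathscr C,\mathscr R)$ consists of a finite set of species $\mathscr S$, complexes $\mathscr C\subseteq\mathbb Z_{\ge0}^{\mathscr S}$, and reactions $y\to y'$ with $y\ne y'$; every complex occurs in some reaction, every species lies in some complex's support, and there are no reactions $\varnothing\to y$. Reactions are indexed $1,\dots,m$, the $i$-th written $y_i\to y_i'$ with rate constant $\kappa_i$. $N$ is a 0,1-network if every complex lies in $\{0,1\}^{\mathscr S}$. $x^y=\prod_s x_s^{y_s}$, and $\dot x_s=\sum_i\kappa_i x^{y_i}(y'_{i,s}-y_{i,s})\in\mathbb K(\kappa)[x]$ is the steady-state polynomial of species $s$ ($\kappa_i$ indeterminates, $\mathbb K$ a field). The network hypergraph $\mathcal H_N$ has $2m$ vertices $u_1,v_1,\dots,u_m,v_m$ ($u_i$ represents the reactant $y_i$ of reaction $i$, $v_i$ its product $y_i'$). Hyperedges: for each species $s$, $E_s=\{u_i: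 s\in\mathrm{supp}(y_i)\}\cup\{v_i: s\in\mathrm{supp}(y_i')\}$; for each reaction $i$, $E_i=\{u_i,v_i\}$ if $y_i'\ne\varnothing$ and $E_i=\varnothing$ otherwise. A multiset $\mathscr E$ over the edges assigns nonnegative multiplicities; a 2-coloring $\mathscr E=\mathscr E_r\sqcup\mathscr E_b$ splits it into two submultisets whose multiplicities add up. $\deg_{\mathscr E_c}(w)$ is the number of edges of $\mathscr E_c$, with multiplicity, containing $w$. A vertex $w$ is almost balanced with respect to the 2-coloring if $\deg_{\mathscr E_r}(w)=\deg_{\mathscr E_b}(w)+k$ for some positive integer $k$ and $\deg_{\mathscr E_r}(z)=\deg_{\mathscr E_b}(z)$ for every other vertex $z$. -}

module Defs where

open import Level using (0ℓ)
open import Data.Nat using (ℕ; zero; suc; _+_; _*_)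
open import Data.Integer as ℤ using (ℤ; +_; -[1+_])
open import Data.Bool using (Bool; true; false; if_then_else_)
open import Data.Fin using (Fin; zero; suc)
open import Data.Product using (Σ; ∃; _×_; _,_)
open import Data.Sum using (_⊎_)
open import Relation.Binary.PropositionalEquality using (_≡_; _≢_)
open import Relation.Nullary using (¬_)
open import Algebra.Bundles using (CommutativeRing)

-- 0,1-networks with species Fin n and reactions Fin m.
-- A complex is a 0,1-vector, i.e. a map Fin n → Bool (its support).

Complex : ℕ → Set
Complex n = Fin n → Bool

record Network01 (n m : ℕ) : Set where
  field
    reactant : Fin m → Complex n
    product  : Fin m → Complex n

record IsNetwork {n m : ℕ} (N : Network01 n m) : Set where
  open Network01 N
  field
    reactant≢product : ∀ i → ¬ (∀ s → reactant i s ≡ product i s)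
    distinct : ∀ i j → i ≢ j →
      ¬ ((∀ s → reactant i s ≡ reactant j s) × (∀ s → product i s ≡ product j s))
    reactant-nonempty : ∀ i → ∃ λ s → reactant i s ≡ true
    species-used : ∀ s → ∃ λ i → (reactant i s ≡ true) ⊎ (product i s ≡ true)

sumℕ : (k : ℕ) → (Fin k → ℕ) → ℕ
sumℕ zero    f = 0
sumℕ (suc k) f = f zero + sumℕ k (λ i → f (suc i))

[_] : Bool → ℕ
[ b ] = if b then 1 else 0

-- vertices: u i (reactant of reaction i), v i (product of reaction i)
data Vertex (m : ℕ) : Set where
  u v : Fin m → Vertex m

data Edge (n m : ℕ) : Set where
  sp : Fin n → Edge n m
  rx : Fin m → Edge n m

_==ᶠ_ : {m : ℕ} → Fin m → Fin m → Bool
zero  ==ᶠ zero  = true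
suc i ==ᶠ suc j = i ==ᶠ j
_     ==ᶠ _     = false

nonemptyᴮ : {n : ℕ} → Complex n → Bool
nonemptyᴮ {zero}  y = false
nonemptyᴮ {suc n} y = if y zero then true else nonemptyᴮ {n} (λ s → y (suc s))

_∋ᴴ_ : {n m : ℕ} {N : Network01 n m} → Edge n m → Vertex m → Bool
_∋ᴴ_ {N = N} (sp s) (u i) = Network01.reactant N i s
_∋ᴴ_ {N = N} (sp s) (v i) = Network01.product N i s
_∋ᴴ_ {N = N} (rx i) (u j) = if i ==ᶠ j then nonemptyᴮ (Network01.product N i) else false
_∋ᴴ_ {N = N} (rx i) (v j) = if i ==ᶠ j then nonemptyᴮ (Network01.product N i) else false

Multiset : ℕ → ℕ → Set
Multiset n m = Edge n m → ℕ

deg : {n m : ℕ} (N : Network01 n m) → Multiset n m → Vertex m → ℕ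
deg {n} {m} N c w =
  sumℕ n (λ s → c (sp s) * [ _∋ᴴ_ {N = N} (sp s) w ])
  + sumℕ m (λ i → c (rx i) * [ _∋ᴴ_ {N = N} (rx i) w ])

IsColoring : {n m : ℕ} → Multiset n m → Multiset n m → Multiset n m → Set
IsColoring E Er Eb = ∀ e → Er e + Eb e ≡ E e

AlmostBalanced : {n m : ℕ} (N : Network01 n m) →
                 Multiset n m → Multiset n m → Vertex m → Set
AlmostBalanced N Er Eb w =
  (Σ ℕ λ k → (k ≢ 0) × (deg N Er w ≡ deg N Eb w + k))
  × (∀ z → z ≢ w → deg N Er z ≡ deg N Eb z)

-- Polynomial expressions, evaluated in an arbitrary commutative ring R.
-- (κ_i and x_s are arbitrary elements of R.)

module _ (R : CommutativeRing 0ℓ 0ℓ) where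
  open CommutativeRing R using (Carrier; 0#; 1#; -_) renaming (_+_ to _+ᴿ_; _*_ to _*ᴿ_)

  sumR : (k : ℕ) → (Fin k → Carrier) → Carrier
  sumR zero    f = 0#
  sumR (suc k) f = f zero +ᴿ sumR k (λ i → f (suc i))

  prodR : (k : ℕ) → (Fin k → Carrier) → Carrier
  prodR zero    f = 1#
  prodR (suc k) f = f zero *ᴿ prodR k (λ i → f (suc i))

  natR : ℕ → Carrier
  natR zero    = 0#
  natR (suc k) = 1# +ᴿ natR k

  intR : ℤ → Carrier
  intR (+ k)     = natR k
  intR -[1+ k ]  = - natR (suc k)

  monomial : {n : ℕ} → (Fin n → Carrier) → Complex n → Carrier
  monomial {n} x y = prodR n (λ s → if y s then x s else 1#)

  boolℤ : Bool → ℤ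
  boolℤ b = + [ b ]

  xdot : {n m : ℕ} → Network01 n m → (Fin m → Carrier) → (Fin n → Carrier) →
         Fin n → Carrier
  xdot {n} {m} N κ x s =
    sumR m (λ i → κ i *ᴿ monomial x (Network01.reactant N i)
                      *ᴿ intR (boolℤ (Network01.product N i s) ℤ.- boolℤ (Network01.reactant N i s)))

  speciesSum : {n m : ℕ} → Network01 n m → (Fin m → Carrier) → (Fin n → Carrier) →
               Multiset n m → Carrier
  speciesSum {n} N κ x C = sumR n (λ s → natR (C (sp s)) *ᴿ xdot N κ x s)

module Submission where

open import Defs
open import Level using (0ℓ)
open import Data.Nat using (ℕ)
open import Data.Fin using (Fin)
open import Data.Product using (Σ; _×_)
open import Relation.Binary.PropositionalEquality using (_≢_)
open import Algebra.Bundles using (CommutativeRing)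

open import Data.Bool using (true; false; if_then_else_)
import Data.Integer as ℤ
open import Data.Fin using (zero; suc)
open import Data.Product using (_,_)
open import Relation.Binary.PropositionalEquality using (_≡_)
import Relation.Binary.PropositionalEquality as ≡

-- Split deg C w = speciesDeg C w + reactionDeg C w.  A reaction edge E_i contains u_i
-- exactly when it contains v_i, so reactionDeg C (u_i) = reactionDeg C (v_i), and the
-- balance conditions at u_i and v_i say that the species edges alone satisfy
--   speciesDeg Er (v_i) - speciesDeg Er (u_i) - (speciesDeg Eb (v_i) - speciesDeg Eb (u_i)) = k δ_ij.
-- On the other hand, exchanging the sums over species and reactions,
--   Σ_s C_s ẋ_s = Σ_i κ_i x^{y_i} (speciesDeg C (v_i) - speciesDeg C (u_i)),
-- since species s lies in y'_i (resp. y_i) iff E_s contains v_i (resp. u_i).  Subtracting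
-- this identity for Eb from the one for Er leaves k κ_j x^{y_j}.

module _ where
  open import Data.Nat using (_+_; _*_)
  open import Data.Nat.Properties using (+-cancelʳ-≡; +-identityʳ)
  open import Data.Nat.Solver using (module +-*-Solver)
  open +-*-Solver
  open ≡ using (refl; sym; trans; cong; cong₂; module ≡-Reasoning)

  ==ᶠ-refl : ∀ {m} (i : Fin m) → (i ==ᶠ i) ≡ true
  ==ᶠ-refl zero    = refl
  ==ᶠ-refl (suc i) = ==ᶠ-refl i

  ==ᶠ⇒≡ : ∀ {m} (i j : Fin m) → (i ==ᶠ j) ≡ true → i ≡ j
  ==ᶠ⇒≡ zero    zero    _ = refl
  ==ᶠ⇒≡ (suc i) (suc j) p = cong suc (==ᶠ⇒≡ i j p)

  single : ∀ {m} → Fin m → ℕ → Fin m → ℕ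
  single j k i = if i ==ᶠ j then k else 0

  +-exchange-cancel : ∀ a b c d t t′ e →
    a + t ≡ (c + t′) + e → b + t ≡ d + t′ → a + d ≡ (c + b) + e
  +-exchange-cancel a b c d t t′ e p q = +-cancelʳ-≡ (t + t′) _ _ (begin
    a + d + (t + t′)       ≡⟨ solve 4 (λ a d t t′ → a :+ d :+ (t :+ t′) := a :+ t :+ (d :+ t′)) refl a d t t′ ⟩
    a + t + (d + t′)       ≡⟨ cong₂ _+_ p (sym q) ⟩
    c + t′ + e + (b + t)   ≡⟨ solve 5 (λ c t′ e b t → c :+ t′ :+ e :+ (b :+ t) := c :+ b :+ e :+ (t :+ t′)) refl c t′ e b t ⟩
    c + b + e + (t + t′)   ∎)
    where open ≡-Reasoning

  module _ {n m : ℕ} (N : Network01 n m) where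

    speciesDeg reactionDeg : Multiset n m → Vertex m → ℕ
    speciesDeg  C w = sumℕ n (λ s → C (sp s) * [ _∋ᴴ_ {N = N} (sp s) w ])
    reactionDeg C w = sumℕ m (λ i → C (rx i) * [ _∋ᴴ_ {N = N} (rx i) w ])

    almostBalanced⇒speciesDeg-exchange : ∀ (Er Eb : Multiset n m) j k →
      deg N Er (v j) ≡ deg N Eb (v j) + k →
      (∀ z → z ≢ v j → deg N Er z ≡ deg N Eb z) →
      ∀ i → speciesDeg Er (v i) + speciesDeg Eb (u i)
          ≡ (speciesDeg Eb (v i) + speciesDeg Er (u i)) + single j k i
    -- In balanced (u i), deg N C (u i) unfolds to speciesDeg C (u i) + reactionDeg C (v i),
    -- since the reaction edge E_i contains u i exactly when it contains v i.
    almostBalanced⇒speciesDeg-exchange Er Eb j k excess balanced i =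
      +-exchange-cancel (speciesDeg Er (v i)) (speciesDeg Er (u i))
                        (speciesDeg Eb (v i)) (speciesDeg Eb (u i))
                        (reactionDeg Er (v i)) (reactionDeg Eb (v i)) (single j k i)
                        deg-v (balanced (u i) λ ())
      where
      deg-v : deg N Er (v i) ≡ deg N Eb (v i) + single j k i
      deg-v with i ==ᶠ j in i==j
      ... | true with ==ᶠ⇒≡ i j i==j
      ...   | refl = excess
      deg-v | false = trans (balanced (v i) v≢) (sym (+-identityʳ _))
        where
        v≢ : v i ≢ v j
        v≢ refl with () ← trans (sym (==ᶠ-refl i)) i==j

module _ (R : CommutativeRing 0ℓ 0ℓ) where
  open CommutativeRing R hiding (zero)
  open import Data.Nat using () renaming (_+_ to _+ℕ_; _*_ to _*ℕ_)
  open import Algebra.Properties.Semiring.Sum semiring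
    using (sum; sum-cong-≋; sum-cong-≗; sum-replicate-zero; ∑-distrib-+; ∑-comm; *-distribˡ-sum)
  open import Algebra.Properties.Semiring.Mult semiring using (×-homo-+; ×1-homo-*)
    renaming (_×_ to _·_)
  open import Algebra.Properties.Ring ring using (-1*x≈-x; x[y-z]≈xy-xz)
  open import Algebra.Properties.AbelianGroup +-abelianGroup using (⁻¹-anti-homo‿-; ⁻¹-∙-comm; xyx⁻¹≈y)
  open import Algebra.Properties.CommutativeSemigroup +-commutativeSemigroup using (interchange)
  open import Algebra.Properties.CommutativeSemigroup *-commutativeSemigroup
    using () renaming (x∙yz≈y∙xz to x*yz≈y*xz)
  open import Algebra.Properties.Group +-group using (ε⁻¹≈ε)
  open import Relation.Binary.Reasoning.Setoid setoid

  sumR≡sum : ∀ k (f : Fin k → Carrier) → sumR R k f ≡ sum f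
  sumR≡sum ℕ.zero    f = ≡.refl
  sumR≡sum (ℕ.suc k) f = ≡.cong (f zero +_) (sumR≡sum k (λ i → f (suc i)))

  natR≡·1# : ∀ k → natR R k ≡ k · 1#
  natR≡·1# ℕ.zero    = ≡.refl
  natR≡·1# (ℕ.suc k) = ≡.cong (1# +_) (natR≡·1# k)

  natR-+ : ∀ a b → natR R (a +ℕ b) ≈ natR R a + natR R b
  natR-+ a b = begin
    natR R (a +ℕ b)        ≡⟨ natR≡·1# (a +ℕ b) ⟩
    (a +ℕ b) · 1#          ≈⟨ ×-homo-+ 1# a b ⟩
    a · 1# + b · 1#        ≡⟨ ≡.cong₂ _+_ (natR≡·1# a) (natR≡·1# b) ⟨
    natR R a + natR R b    ∎

  natR-* : ∀ a b → natR R (a *ℕ b) ≈ natR R a * natR R b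
  natR-* a b = begin
    natR R (a *ℕ b)        ≡⟨ natR≡·1# (a *ℕ b) ⟩
    (a *ℕ b) · 1#          ≈⟨ ×1-homo-* a b ⟩
    a · 1# * b · 1#        ≡⟨ ≡.cong₂ _*_ (natR≡·1# a) (natR≡·1# b) ⟨
    natR R a * natR R b    ∎

  natR-sumℕ : ∀ k (f : Fin k → ℕ) → natR R (sumℕ k f) ≈ sum (λ i → natR R (f i))
  natR-sumℕ ℕ.zero    f = refl
  natR-sumℕ (ℕ.suc k) f = trans (natR-+ (f zero) _) (+-congˡ (natR-sumℕ k (λ i → f (suc i))))

  -‿sum : ∀ {k} (f : Fin k → Carrier) → - sum f ≈ sum (λ i → - f i)
  -‿sum f = begin
    - sum f                 ≈⟨ -1*x≈-x (sum f) ⟨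
    - 1# * sum f            ≈⟨ *-distribˡ-sum (- 1#) f ⟩
    sum (λ i → - 1# * f i)  ≈⟨ sum-cong-≋ (λ i → -1*x≈-x (f i)) ⟩
    sum (λ i → - f i)       ∎

  ∑-distrib-- : ∀ {k} (f g : Fin k → Carrier) → sum (λ i → f i - g i) ≈ sum f - sum g
  ∑-distrib-- f g = trans (∑-distrib-+ f (λ i → - g i)) (+-congˡ (sym (-‿sum g)))

  ∑-single : ∀ {m} (g : Fin m → Carrier) j k →
    sum (λ i → g i * natR R (single j k i)) ≈ g j * natR R k
  ∑-single {ℕ.suc m} g zero k = begin
    g zero * natR R k + sum (λ i → g (suc i) * 0#)
      ≈⟨ +-congˡ (trans (sum-cong-≋ (λ i → zeroʳ (g (suc i)))) (sum-replicate-zero m)) ⟩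
    g zero * natR R k + 0#
      ≈⟨ +-identityʳ _ ⟩
    g zero * natR R k ∎
  ∑-single {ℕ.suc m} g (suc j) k = begin
    g zero * 0# + sum (λ i → g (suc i) * natR R (single j k i))
      ≈⟨ +-cong (zeroʳ (g zero)) (∑-single (λ i → g (suc i)) j k) ⟩
    0# + g (suc j) * natR R k
      ≈⟨ +-identityˡ _ ⟩
    g (suc j) * natR R k ∎

  diff-of-diffs : ∀ {x y z w e} → x + w ≈ (z + y) + e → (x - y) - (z - w) ≈ e
  diff-of-diffs {x} {y} {z} {w} {e} eq = begin
    (x - y) - (z - w)      ≈⟨ +-congˡ (⁻¹-anti-homo‿- z w) ⟩
    (x - y) + (w - z)      ≈⟨ interchange x (- y) w (- z) ⟩
    (x + w) + (- y - z)    ≈⟨ +-congˡ (trans (+-comm (- y) (- z)) (⁻¹-∙-comm z y)) ⟩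
    (x + w) - (z + y)      ≈⟨ +-congʳ eq ⟩
    (z + y) + e - (z + y)  ≈⟨ xyx⁻¹≈y (z + y) e ⟩
    e                      ∎

  natR-diff-of-diffs : ∀ a b c d e → a +ℕ d ≡ (c +ℕ b) +ℕ e →
    (natR R a - natR R b) - (natR R c - natR R d) ≈ natR R e
  natR-diff-of-diffs a b c d e eq = diff-of-diffs (begin
    natR R a + natR R d                ≈⟨ natR-+ a d ⟨
    natR R (a +ℕ d)                    ≡⟨ ≡.cong (natR R) eq ⟩
    natR R ((c +ℕ b) +ℕ e)             ≈⟨ natR-+ (c +ℕ b) e ⟩
    natR R (c +ℕ b) + natR R e         ≈⟨ +-congʳ (natR-+ c b) ⟩
    (natR R c + natR R b) + natR R e   ∎)

  intR-boolDiff : ∀ a b → intR R (boolℤ R a ℤ.- boolℤ R b) ≈ natR R [ a ] - natR R [ b ]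
  intR-boolDiff true  true  = sym (-‿inverseʳ _)
  intR-boolDiff true  false = sym (trans (+-congˡ ε⁻¹≈ε) (+-identityʳ _))
  intR-boolDiff false true  = sym (+-identityˡ _)
  intR-boolDiff false false = sym (trans (+-congˡ ε⁻¹≈ε) (+-identityʳ _))

  module _ {n m : ℕ} (N : Network01 n m) where
    open Network01 N

    netChange : Multiset n m → Fin m → Carrier
    netChange C i = natR R (speciesDeg N C (v i)) - natR R (speciesDeg N C (u i))

    stoich : Fin m → Fin n → Carrier
    stoich i s = intR R (boolℤ R (product i s) ℤ.- boolℤ R (reactant i s))

    natR-speciesDeg : ∀ C w →
      natR R (speciesDeg N C w) ≈ sum (λ s → natR R (C (sp s)) * natR R [ _∋ᴴ_ {N = N} (sp s) w ])
    natR-speciesDeg C w = trans (natR-sumℕ n _) (sum-cong-≋ (λ s → natR-* (C (sp s)) _))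

    ∑-weighted-stoich : ∀ C i → sum (λ s → natR R (C (sp s)) * stoich i s) ≈ netChange C i
    ∑-weighted-stoich C i = begin
      sum (λ s → c s * stoich i s)
        ≈⟨ sum-cong-≋ (λ s → *-congˡ (intR-boolDiff (product i s) (reactant i s))) ⟩
      sum (λ s → c s * (natR R [ product i s ] - natR R [ reactant i s ]))
        ≈⟨ sum-cong-≋ (λ s → x[y-z]≈xy-xz (c s) _ _) ⟩
      sum (λ s → c s * natR R [ product i s ] - c s * natR R [ reactant i s ])
        ≈⟨ ∑-distrib-- {n} _ _ ⟩
      sum (λ s → c s * natR R [ product i s ]) - sum (λ s → c s * natR R [ reactant i s ])
        ≈⟨ +-cong (natR-speciesDeg C (v i)) (-‿cong (natR-speciesDeg C (u i))) ⟨
      netChange C i ∎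
      where
      c : Fin n → Carrier
      c s = natR R (C (sp s))

    module _ (κ : Fin m → Carrier) (x : Fin n → Carrier) where

      rate : Fin m → Carrier
      rate i = κ i * monomial R x (reactant i)

      speciesSum≈∑rate*netChange : ∀ C →
        speciesSum R N κ x C ≈ sum (λ i → rate i * netChange C i)
      speciesSum≈∑rate*netChange C = begin
        speciesSum R N κ x C
          ≡⟨ sumR≡sum n _ ⟩
        sum (λ s → c s * xdot R N κ x s)
          ≡⟨ sum-cong-≗ (λ s → ≡.cong (c s *_) (sumR≡sum m _)) ⟩
        sum (λ s → c s * sum (λ i → rate i * stoich i s))
          ≈⟨ sum-cong-≋ (λ s → *-distribˡ-sum {m} (c s) _) ⟩
        sum (λ s → sum (λ i → c s * (rate i * stoich i s)))
          ≈⟨ ∑-comm {n} {m} _ ⟩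
        sum (λ i → sum (λ s → c s * (rate i * stoich i s)))
          ≈⟨ sum-cong-≋ (λ i → trans (sum-cong-≋ (λ s → x*yz≈y*xz (c s) (rate i) _))
                                      (sym (*-distribˡ-sum {n} (rate i) _))) ⟩
        sum (λ i → rate i * sum (λ s → c s * stoich i s))
          ≈⟨ sum-cong-≋ (λ i → *-congˡ (∑-weighted-stoich C i)) ⟩
        sum (λ i → rate i * netChange C i) ∎
        where
        c : Fin n → Carrier
        c s = natR R (C (sp s))

      speciesSum-difference : ∀ (Er Eb : Multiset n m) j k →
        (∀ i → speciesDeg N Er (v i) +ℕ speciesDeg N Eb (u i)
             ≡ (speciesDeg N Eb (v i) +ℕ speciesDeg N Er (u i)) +ℕ single j k i) →
        speciesSum R N κ x Er - speciesSum R N κ x Eb ≈ rate j * natR R k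
      speciesSum-difference Er Eb j k exchange = begin
        speciesSum R N κ x Er - speciesSum R N κ x Eb
          ≈⟨ +-cong (speciesSum≈∑rate*netChange Er) (-‿cong (speciesSum≈∑rate*netChange Eb)) ⟩
        sum (λ i → rate i * netChange Er i) - sum (λ i → rate i * netChange Eb i)
          ≈⟨ ∑-distrib-- {m} _ _ ⟨
        sum (λ i → rate i * netChange Er i - rate i * netChange Eb i)
          ≈⟨ sum-cong-≋ (λ i → x[y-z]≈xy-xz (rate i) _ _) ⟨
        sum (λ i → rate i * (netChange Er i - netChange Eb i))
          ≈⟨ sum-cong-≋ (λ i → *-congˡ (netChange-exchange i)) ⟩
        sum (λ i → rate i * natR R (single j k i))
          ≈⟨ ∑-single rate j k ⟩
        rate j * natR R k ∎
        where
        netChange-exchange : ∀ i → netChange Er i - netChange Eb i ≈ natR R (single j k i)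
        netChange-exchange i =
          natR-diff-of-diffs (speciesDeg N Er (v i)) (speciesDeg N Er (u i))
                             (speciesDeg N Eb (v i)) (speciesDeg N Eb (u i)) (single j k i)
                             (exchange i)

proposition3p6 : (R : CommutativeRing 0ℓ 0ℓ) → (n m : ℕ) → (N : Network01 n m) → IsNetwork N →
    (E Er Eb : Multiset n m) → IsColoring E Er Eb → (j : Fin m) →
    AlmostBalanced N Er Eb (Vertex.v j) →
    Σ ℕ (λ k → (k ≢ 0) ×
      ((κ : Fin m → CommutativeRing.Carrier R) → (x : Fin n → CommutativeRing.Carrier R) →
        CommutativeRing._≈_ R
          (CommutativeRing._*_ R (CommutativeRing._*_ R (natR R k) (κ j)) (monomial R x (Network01.reactant N j)))
          (CommutativeRing._-_ R (speciesSum R N κ x Er) (speciesSum R N κ x Eb))))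
proposition3p6 R n m N _ _ Er Eb _ j ((k , k≢0 , excess) , balanced) = k , k≢0 , identity
  where
  open CommutativeRing R
  open import Relation.Binary.Reasoning.Setoid setoid

  identity : ∀ κ x → natR R k * κ j * monomial R x (Network01.reactant N j)
                   ≈ speciesSum R N κ x Er - speciesSum R N κ x Eb
  identity κ x = begin
    natR R k * κ j * monomial R x (Network01.reactant N j)  ≈⟨ *-assoc _ _ _ ⟩
    natR R k * rate R N κ x j                               ≈⟨ *-comm _ _ ⟩
    rate R N κ x j * natR R k
      ≈⟨ speciesSum-difference R N κ x Er Eb j k
           (almostBalanced⇒speciesDeg-exchange N Er Eb j k excess balanced) ⟨
    speciesSum R N κ x Er - speciesSum R N κ x Eb           ∎
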